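{- Let $X$ be an ideal of black-white colorings (an ideal in $(\mathcal{C}(D_2),\preceq)$). If there is $i\in\{1,2\}$ such that for every $r\ge1$ the set $X$ contains an $r$-wealthy coloring of type $i$, then $|X_n|\ge F_n$ for all $n\ge1$, where $F_0=F_1=1$ and $F_n=F_{n-1}+F_{n-2}$.
   Context: A coloring is a pair $(n,\chi)$ with $n\in\mathbb{N}_0$ and $\chi:\binom{[n]}{2}\to\{\text{black},\text{white}\}$; $(m,\psi)\preceq(n,\chi)$ iff there is an increasing $f:[m]\to[n]$ with $\psi(\{i,j\})=\chi(\{f(i),f(j)\})$ for all $i<j$. An ideal is a down-closed set of colorings; $X_n=\{(n,\chi)\in X\}$. The reversal of $(n,\chi)$ is $(n,\psi)$ with $\psi(\{i,j\})=\chi(\{n-i+1,n-j+1\})$. A coloring $(r,\chi)$ is $r$-wealthy of type 1 if in it or in its reversal $\chi(\{1,i\})\ne\chi(\{1,i+1\})$ for all $i\in\{2,\dots,r-1\}$. A coloring $(3r,\chi)$ is $r$-wealthy of type 2 if none of the triangles $\{3i-2,3i-1,3i\}$, $1\le i\le r$, is monochromatic under $\chi$. -}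

module Defs where

open import Data.Nat using (ℕ; zero; suc; _+_; _*_; _≤_)
open import Data.Fin using (Fin; toℕ; opposite; _<_)
open import Data.Bool using (Bool)
open import Data.Product using (Σ; _×_)
open import Data.Sum using (_⊎_)
open import Relation.Binary.PropositionalEquality using (_≡_; _≢_)
open import Relation.Nullary using (¬_)

-- Colours: Bool (true = black, false = white).
-- A coloring (n , χ): vertices [n] are represented by Fin n (vertex k+1 ↦ k).
-- χ is given as a function Fin n → Fin n → Bool of which ONLY the values
-- χ i j with i < j are meaningful (they give the colour of the edge {i,j});
-- all notions below only ever inspect χ i j for i < j.
record Coloring : Set where
  constructor mkCol
  field
    size : ℕ
    col  : Fin size → Fin size → Bool
open Coloring public

SameCol : {n : ℕ} → (Fin n → Fin n → Bool) → (Fin n → Fin n → Bool) → Set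
SameCol {n} χ ψ = (i j : Fin n) → i < j → χ i j ≡ ψ i j

_≼_ : Coloring → Coloring → Set
c ≼ d = Σ (Fin (size c) → Fin (size d)) λ f →
          ((i j : Fin (size c)) → i < j → f i < f j) ×
          ((i j : Fin (size c)) → i < j → col c i j ≡ col d (f i) (f j))

IsIdeal : (Coloring → Set) → Set
IsIdeal X = (c d : Coloring) → c ≼ d → X d → X c

-- reversal: edge {i,j} (i<j) gets the colour of {n-i+1, n-j+1};
-- opposite j < opposite i, so arguments are swapped to keep "first < second".
reversal : {n : ℕ} → (Fin n → Fin n → Bool) → (Fin n → Fin n → Bool)
reversal χ i j = χ (opposite j) (opposite i)

-- χ{1,i} ≠ χ{1,i+1} for all i ∈ {2,…,r-1}  (0-indexed: vertex z = 1, b = i, c = i+1)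
Alternating : {r : ℕ} → (Fin r → Fin r → Bool) → Set
Alternating {r} χ = (z b c : Fin r) → toℕ z ≡ 0 → 1 ≤ toℕ b → toℕ c ≡ suc (toℕ b) →
                    χ z b ≢ χ z c

Wealthy1 : ℕ → Coloring → Set
Wealthy1 r c = (size c ≡ r) × (Alternating (col c) ⊎ Alternating (reversal (col c)))

Mono : {n : ℕ} → (Fin n → Fin n → Bool) → Fin n → Fin n → Fin n → Set
Mono χ a b c = (χ a b ≡ χ a c) × (χ a b ≡ χ b c)

-- r-wealthy of type 2: a coloring (3r,χ) with none of the triangles
-- {3i-2,3i-1,3i}, 1 ≤ i ≤ r (0-indexed {3i,3i+1,3i+2}, 0 ≤ i < r) monochromatic
Wealthy2 : ℕ → Coloring → Set
Wealthy2 r c = (size c ≡ 3 * r) ×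
  ((i : ℕ) (a b d : Fin (size c)) → toℕ a ≡ 3 * i → toℕ b ≡ 3 * i + 1 → toℕ d ≡ 3 * i + 2 →
     ¬ Mono (col c) a b d)

F : ℕ → ℕ
F zero = 1
F (suc zero) = 1
F (suc (suc n)) = F (suc n) + F n

RichIn : (ℕ → Coloring → Set) → (Coloring → Set) → Set
RichIn W X = (r : ℕ) → 1 ≤ r → Σ Coloring λ c → X c × W r c

-- |X_n| ≥ k : there are k pairwise distinct colorings of size n in X
AtLeast : (Coloring → Set) → ℕ → ℕ → Set
AtLeast X n k = Σ (Fin k → (Fin n → Fin n → Bool)) λ g →
  ((a : Fin k) → X (mkCol n (g a))) ×
  ((a b : Fin k) → a ≢ b → ¬ SameCol (g a) (g b))

-- For every tiling of [n] by squares and dominoes (there are F n of them) we pick an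
-- increasing n-vertex sequence in one large wealthy coloring of X, so that distinct tilings
-- induce distinct colorings; all of them lie in X because X is an ideal.  The sequence of a
-- tiling is read from position-indexed blocks (solo, left, right): a square at position k
-- contributes solo k, a domino contributes left k, right k.  Where two tilings first differ,
-- one sequence has solo k and the other left k, right k, and the blocks are chosen so that an
-- edge at that position gets different colours.
--
-- Vertices are numbered from 0.  Type 1: after the root 0, use the blocks (2k+1, 2k+2, 2k+3);
-- the alternation of the star of 0 makes the edges from the root to 2k+1 and 2k+2 differ.  A
-- coloring whose reversal alternates is handled by passing to the ideal of reversals.
--
-- Type 2: call t constant if 3t sends one colour to 3t+1, …, 3t+4.  A greedy scan yields either
-- n consecutive constant t or n+2 non-constant ones.  In the first case the blocks are the
-- triangles themselves: as T_t is not monochromatic, its edge {3t+1,3t+2} differs from the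
-- star colour of 3t.  In the second the blocks are (3t, 3t, q) with q ∈ 3t+1 … 3t+4 such that
-- {3t,q} differs from {3t,3t'} for the next point t'.

module Submission where

open import Defs
open import Data.Nat using (ℕ; zero; suc; _+_; _*_; _≤_; _<_; z≤n; s≤s; z<s; _<?_)
open import Data.Nat.Properties
open import Data.Fin as Fin using (Fin; toℕ; fromℕ<; opposite; splitAt; join; _↑ˡ_; _↑ʳ_)
open import Data.Fin.Properties
  using (toℕ<n; toℕ-fromℕ<; opposite-prop; opposite-involutive; join-splitAt)
open import Data.Bool using (Bool; false)
open import Data.Bool.Properties using () renaming (_≟_ to _≟ᵇ_)
open import Data.Product using (Σ; ∃; _×_; _,_; proj₁; proj₂)
open import Data.Sum as Sum using (_⊎_; inj₁; inj₂; [_,_]′)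
open import Data.Sum.Properties using ([,]-∘; [,]-cong)
open import Data.Empty using (⊥-elim)
open import Function using (_∘_; id)
open import Relation.Binary.PropositionalEquality
open import Relation.Nullary using (¬_; yes; no; contradiction)
open import Relation.Nullary.Decidable using (_×-dec_; ¬?; decidable-stable)
open import Relation.Unary using (Decidable)

private
  variable
    n K N : ℕ

-- Off [0, size c) the value is junk; every sequence it is applied to stays below size c.
colℕ : Coloring → ℕ → ℕ → Bool
colℕ c x y with x <? size c | y <? size c
... | yes x<N | yes y<N = col c (fromℕ< x<N) (fromℕ< y<N)
... | _       | _       = false

colℕ-fromℕ< : (c : Coloring) {x y : ℕ} (x<N : x < size c) (y<N : y < size c) →
              colℕ c x y ≡ col c (fromℕ< x<N) (fromℕ< y<N)
colℕ-fromℕ< c {x} {y} x<N y<N with x <? size c | y <? size c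
... | yes _  | yes _  = refl
... | no x≮N | _      = contradiction x<N x≮N
... | yes _  | no y≮N = contradiction y<N y≮N

Increasing : ℕ → (ℕ → ℕ) → Set
Increasing n u = ∀ i → suc i < n → u i < u (suc i)

increasing⇒< : {u : ℕ → ℕ} → Increasing n u → ∀ {i j} → i < j → j < n → u i < u j
increasing⇒< inc {i} {suc j} i<1+j 1+j<n with m<1+n⇒m<n∨m≡n i<1+j
... | inj₁ i<j  = <-trans (increasing⇒< inc i<j (<-trans (n<1+n j) 1+j<n)) (inc j 1+j<n)
... | inj₂ refl = inc i 1+j<n

record Distinguished (χ : ℕ → ℕ → Bool) (n : ℕ) (u v : ℕ → ℕ) : Set where
  constructor at-edge
  field
    i j    : ℕ
    i<j    : i < j
    j<n    : j < n
    differ : χ (u i) (u j) ≢ χ (v i) (v j)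

distinguished-sym : ∀ {χ u v} → Distinguished χ n u v → Distinguished χ n v u
distinguished-sym (at-edge i j i<j j<n differ) = at-edge i j i<j j<n (differ ∘ sym)

record Embeddings (χ : ℕ → ℕ → Bool) (N n K : ℕ) : Set where
  field
    seq           : Fin K → ℕ → ℕ
    increasing    : ∀ a → Increasing n (seq a)
    bounded       : ∀ a i → i < n → seq a i < N
    distinguished : ∀ a b → a ≢ b → Distinguished χ n (seq a) (seq b)

embeddings⇒atLeast : {X : Coloring → Set} → IsIdeal X → (c : Coloring) → X c →
          Embeddings (colℕ c) (size c) n K → AtLeast X n K
embeddings⇒atLeast {n} {K} {X} ideal c Xc E = induced , induced∈X , induced-distinct
  where
  open Embeddings E

  induced : Fin K → Fin n → Fin n → Bool
  induced a i j = colℕ c (seq a (toℕ i)) (seq a (toℕ j))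

  embedding : Fin K → Fin n → Fin (size c)
  embedding a i = fromℕ< (bounded a (toℕ i) (toℕ<n i))

  toℕ-embedding : ∀ a i → toℕ (embedding a i) ≡ seq a (toℕ i)
  toℕ-embedding a i = toℕ-fromℕ< (bounded a (toℕ i) (toℕ<n i))

  induced≼c : ∀ a → mkCol n (induced a) ≼ c
  induced≼c a = embedding a
              , (λ i j i<j → subst₂ _<_ (sym (toℕ-embedding a i)) (sym (toℕ-embedding a j))
                                        (increasing⇒< (increasing a) i<j (toℕ<n j)))
              , (λ i j _ → colℕ-fromℕ< c (bounded a (toℕ i) (toℕ<n i))
                                         (bounded a (toℕ j) (toℕ<n j)))

  induced∈X : ∀ a → X (mkCol n (induced a))
  induced∈X a = ideal _ c (induced≼c a) Xc

  induced-distinct : ∀ a b → a ≢ b → ¬ SameCol (induced a) (induced b)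
  induced-distinct a b a≢b same with distinguished a b a≢b
  ... | at-edge i j i<j j<n differ = differ (subst₂ agree (toℕ-fromℕ< i<n) (toℕ-fromℕ< j<n)
                                                   (same (fromℕ< i<n) (fromℕ< j<n) i'<j'))
    where
    i<n : i < n
    i<n = <-trans i<j j<n
    agree : ℕ → ℕ → Set
    agree x y = colℕ c (seq a x) (seq a y) ≡ colℕ c (seq b x) (seq b y)
    i'<j' : fromℕ< i<n Fin.< fromℕ< j<n
    i'<j' = subst₂ _<_ (sym (toℕ-fromℕ< i<n)) (sym (toℕ-fromℕ< j<n)) i<j

-- Tilings and walks

data Tiling : ℕ → Set where
  []     : Tiling 0
  square : Tiling n → Tiling (suc n)
  domino : Tiling n → Tiling (suc (suc n))

tiling : ∀ n → Fin (F n) → Tiling n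
tiling zero          _ = []
tiling (suc zero)    _ = square []
tiling (suc (suc n)) a = [ square ∘ tiling (suc n) , domino ∘ tiling n ]′ (splitAt (F (suc n)) a)

index : Tiling n → Fin (F n)
index []                 = Fin.zero
index (square {zero} _)  = Fin.zero
index (square {suc n} t) = index t ↑ˡ F n
index (domino {n} t)     = F (suc n) ↑ʳ index t

index-tiling : ∀ n (a : Fin (F n)) → index (tiling n a) ≡ a
index-tiling zero          Fin.zero = refl
index-tiling (suc zero)    Fin.zero = refl
index-tiling (suc (suc n)) a = begin
  index (tiling (suc (suc n)) a)
    ≡⟨ [,]-∘ index (splitAt (F (suc n)) a) ⟩
  [ index ∘ square ∘ tiling (suc n) , index ∘ domino ∘ tiling n ]′ (splitAt (F (suc n)) a)
    ≡⟨ [,]-cong (cong (_↑ˡ F n) ∘ index-tiling (suc n)) (cong (F (suc n) ↑ʳ_) ∘ index-tiling n)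
                (splitAt (F (suc n)) a) ⟩
  join (F (suc n)) (F n) (splitAt (F (suc n)) a)
    ≡⟨ join-splitAt (F (suc n)) (F n) a ⟩
  a ∎
  where open ≡-Reasoning

tiling-injective : ∀ n {a b} → tiling n a ≡ tiling n b → a ≡ b
tiling-injective n {a} {b} eq =
  trans (sym (index-tiling n a)) (trans (cong index eq) (index-tiling n b))

tiling-embeddings : {χ : ℕ → ℕ → Bool} (w : Tiling n → ℕ → ℕ) →
  (∀ t → Increasing n (w t)) → (∀ t i → i < n → w t i < N) →
  (∀ t t' → t ≢ t' → Distinguished χ n (w t) (w t')) →
  Embeddings χ N n (F n)
tiling-embeddings {n} w inc bnd dist = record
  { seq           = w ∘ tiling n
  ; increasing    = inc ∘ tiling n
  ; bounded       = bnd ∘ tiling n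
  ; distinguished = λ a b a≢b → dist _ _ (a≢b ∘ tiling-injective n)
  }

infixr 5 _∷_
_∷_ : ℕ → (ℕ → ℕ) → ℕ → ℕ
(x ∷ u) zero    = x
(x ∷ u) (suc i) = u i

record Block : Set where
  constructor block
  field
    solo left right : ℕ
open Block

Entry : Block → ℕ → Set
Entry b v = v ≡ solo b ⊎ v ≡ left b

infix 4 _≺_
record _≺_ (x : ℕ) (b : Block) : Set where
  constructor ≺-intro
  field
    <solo : x < solo b
    <left : x < left b

≺-entry : ∀ {x b v} → x ≺ b → Entry b v → x < v
≺-entry (≺-intro x<solo _) (inj₁ refl) = x<solo
≺-entry (≺-intro _ x<left) (inj₂ refl) = x<left

Ordered : (ℕ → Block) → ℕ → Set
Ordered B i = left (B i) < right (B i) × solo (B i) ≺ B (1 + i) × right (B i) ≺ B (2 + i)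

Below : ℕ → Block → Set
Below N b = solo b < N × left b < N × right b < N

walk : (ℕ → Block) → Tiling n → ℕ → ℕ
walk B []         = λ _ → 0
walk B (square t) = solo (B 0) ∷ walk (B ∘ suc) t
walk B (domino t) = left (B 0) ∷ right (B 0) ∷ walk (B ∘ suc ∘ suc) t

walk-entry : (B : ℕ → Block) (t : Tiling (suc n)) → Entry (B 0) (walk B t 0)
walk-entry B (square t) = inj₁ refl
walk-entry B (domino t) = inj₂ refl

walk-increasing : (B : ℕ → Block) → (∀ i → i < n → Ordered B i) →
                  (t : Tiling n) → Increasing n (walk B t)
walk-increasing B ord (square t) zero (s≤s (s≤s _)) =
  ≺-entry (proj₁ (proj₂ (ord 0 z<s))) (walk-entry (B ∘ suc) t)
walk-increasing B ord (square t) (suc i) (s≤s 1+i<n) =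
  walk-increasing (B ∘ suc) (λ k k<n → ord (suc k) (s≤s k<n)) t i 1+i<n
walk-increasing B ord (domino t) zero _ = proj₁ (ord 0 z<s)
walk-increasing B ord (domino t) (suc zero) (s≤s (s≤s (s≤s _))) =
  ≺-entry (proj₂ (proj₂ (ord 0 z<s))) (walk-entry (B ∘ suc ∘ suc) t)
walk-increasing B ord (domino t) (suc (suc i)) (s≤s (s≤s 1+i<n)) =
  walk-increasing (B ∘ suc ∘ suc) (λ k k<n → ord (2 + k) (s≤s (s≤s k<n))) t i 1+i<n

walk-bounded : (B : ℕ → Block) → (∀ i → i < n → Below N (B i)) →
               (t : Tiling n) → ∀ i → i < n → walk B t i < N
walk-bounded B below (square t) zero    _         = proj₁ (below 0 z<s)
walk-bounded B below (square t) (suc i) (s≤s i<n) =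
  walk-bounded (B ∘ suc) (λ k k<n → below (suc k) (s≤s k<n)) t i i<n
walk-bounded B below (domino t) zero          _ = proj₁ (proj₂ (below 0 z<s))
walk-bounded B below (domino t) (suc zero)    _ = proj₂ (proj₂ (below 0 z<s))
walk-bounded B below (domino t) (suc (suc i)) (s≤s (s≤s i<n)) =
  walk-bounded (B ∘ suc ∘ suc) (λ k k<n → below (2 + k) (s≤s (s≤s k<n))) t i i<n

record Branch (B : ℕ → Block) (n : ℕ) (u v : ℕ → ℕ) : Set where
  constructor branch
  field
    at      : ℕ
    at+1<n  : suc at < n
    u-solo  : u at ≡ solo (B at)
    u-next  : Entry (B (suc at)) (u (suc at))
    v-left  : v at ≡ left (B at)
    v-right : v (suc at) ≡ right (B at)

branch-∷ : ∀ {B u v x y} → Branch (B ∘ suc) n u v → Branch B (suc n) (x ∷ u) (y ∷ v)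
branch-∷ (branch k k+1<n u-solo u-next v-left v-right) =
  branch (suc k) (s≤s k+1<n) u-solo u-next v-left v-right

walk-branch : (B : ℕ → Block) (t t' : Tiling n) → t ≢ t' →
              Branch B n (walk B t) (walk B t') ⊎ Branch B n (walk B t') (walk B t)
walk-branch B [] [] []≢[] = ⊥-elim ([]≢[] refl)
walk-branch B (square t) (square t') t≢t' =
  Sum.map (branch-∷ {B = B}) (branch-∷ {B = B}) (walk-branch (B ∘ suc) t t' (t≢t' ∘ cong square))
walk-branch B (domino t) (domino t') t≢t' =
  Sum.map (branch-∷ {B = B} ∘ branch-∷) (branch-∷ {B = B} ∘ branch-∷)
          (walk-branch (B ∘ suc ∘ suc) t t' (t≢t' ∘ cong domino))
walk-branch B (square t) (domino t') _ =
  inj₁ (branch 0 (s≤s z<s) refl (walk-entry (B ∘ suc) t) refl refl)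
walk-branch B (domino t) (square t') _ =
  inj₂ (branch 0 (s≤s z<s) refl (walk-entry (B ∘ suc) t') refl refl)

walk-increasing-∷ : ∀ {x} (B : ℕ → Block) → x ≺ B 0 → (∀ i → i < n → Ordered B i) →
                    (t : Tiling n) → Increasing (suc n) (x ∷ walk B t)
walk-increasing-∷ B x≺B₀ ord t zero    (s≤s (s≤s _)) = ≺-entry x≺B₀ (walk-entry B t)
walk-increasing-∷ B x≺B₀ ord t (suc i) (s≤s 1+i<n)   = walk-increasing B ord t i 1+i<n

increasing-pred : {u : ℕ → ℕ} → Increasing (suc n) u → Increasing n u
increasing-pred inc i 1+i<n = inc i (<-trans 1+i<n (n<1+n _))

Separated : (ℕ → ℕ → Bool) → (ℕ → Block) → ℕ → Set
Separated χ B i = ∀ v → Entry (B (suc i)) v → χ (solo (B i)) v ≢ χ (left (B i)) (right (B i))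

branch⇒distinguished : ∀ {χ B u v} → (∀ i → suc i < n → Separated χ B i) →
                       Branch B n u v → Distinguished χ n u v
branch⇒distinguished {χ = χ} {u = u} {v} sep (branch k k+1<n u-solo u-next v-left v-right) =
  at-edge k (suc k) (n<1+n k) k+1<n differ
  where
  differ : χ (u k) (u (suc k)) ≢ χ (v k) (v (suc k))
  differ rewrite u-solo | v-left | v-right = sep k k+1<n (u (suc k)) u-next

walk-embeddings : (χ : ℕ → ℕ → Bool) (B : ℕ → Block) →
  (∀ i → i < n → Ordered B i) → (∀ i → i < n → Below N (B i)) →
  (∀ i → suc i < n → Separated χ B i) → Embeddings χ N n (F n)
walk-embeddings χ B ord below sep = tiling-embeddings (walk B) (walk-increasing B ord) (walk-bounded B below)
  λ t t' t≢t' → Sum.[ branch⇒distinguished sep , distinguished-sym ∘ branch⇒distinguished sep ]′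
                      (walk-branch B t t' t≢t')

-- Alternating stars

pairBlock : ℕ → Block
pairBlock k = block (1 + 2 * k) (2 + 2 * k) (3 + 2 * k)

pairBlock-ordered : ∀ i → Ordered pairBlock i
pairBlock-ordered i rewrite *-suc 2 (suc i) | *-suc 2 i =
  n<1+n _ , ≺-intro (m<n+m _ {2} z<s) (m<n+m _ {3} z<s) , ≺-intro (m<n+m _ {2} z<s) (m<n+m _ {3} z<s)

pairBlock-below : 2 + 2 * n ≤ N → ∀ {i} → i < n → Below N (pairBlock i)
pairBlock-below {n} {N} 2+2n≤N {i} i<n = <-trans (n<1+n _) left<N , left<N , right<N
  where
  right<N : 3 + 2 * i < N
  right<N = ≤-trans (subst (_≤ 2 + 2 * n) (cong (2 +_) (*-suc 2 i)) (+-monoʳ-≤ 2 (*-monoʳ-≤ 2 i<n)))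
                    2+2n≤N
  left<N : 2 + 2 * i < N
  left<N = <-trans (n<1+n _) right<N

alternating-embeddings : (χ : ℕ → ℕ → Bool) → 2 + 2 * n ≤ N →
  (∀ b → 1 ≤ b → suc b < N → χ 0 b ≢ χ 0 (suc b)) → Embeddings χ N n (F n)
alternating-embeddings {n} {N} χ 2+2n≤N alt =
  tiling-embeddings rooted
    (λ t → increasing-pred
             (walk-increasing-∷ pairBlock (≺-intro z<s z<s) (λ i _ → pairBlock-ordered i) t))
    bounded
    λ t t' t≢t' → Sum.[ separate , distinguished-sym ∘ separate ]′
                        (walk-branch pairBlock t t' t≢t')
  where
  rooted : Tiling n → ℕ → ℕ
  rooted t = 0 ∷ walk pairBlock t

  bounded : ∀ t i → i < n → rooted t i < N
  bounded t zero    _       = ≤-trans z<s 2+2n≤N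
  bounded t (suc i) 1+i<n =
    walk-bounded pairBlock (λ _ → pairBlock-below 2+2n≤N) t i (<-trans (n<1+n i) 1+i<n)

  separate : ∀ {u v} → Branch pairBlock n u v → Distinguished χ n (0 ∷ u) (0 ∷ v)
  separate (branch k k+1<n u-solo _ v-left _) = at-edge 0 (suc k) z<s k+1<n λ same →
    alt (1 + 2 * k) z<s (proj₁ (proj₂ (pairBlock-below 2+2n≤N (<-trans (n<1+n k) k+1<n))))
        (trans (cong (χ 0) (sym u-solo)) (trans same (cong (χ 0) v-left)))

-- Colorings without monochromatic triangles

MonoTriangle : (ℕ → ℕ → Bool) → ℕ → Set
MonoTriangle χ x = χ x (1 + x) ≡ χ x (2 + x) × χ x (1 + x) ≡ χ (1 + x) (2 + x)

ConstantStar : (ℕ → ℕ → Bool) → ℕ → Set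
ConstantStar χ x =
  χ x (1 + x) ≡ χ x (2 + x) × χ x (1 + x) ≡ χ x (3 + x) × χ x (1 + x) ≡ χ x (4 + x)

constantStar? : (χ : ℕ → ℕ → Bool) → Decidable (ConstantStar χ)
constantStar? χ x = (_ ≟ᵇ _) ×-dec (_ ≟ᵇ _) ×-dec (_ ≟ᵇ _)

constantStar-separates : ∀ {χ x} → ConstantStar χ x → ¬ MonoTriangle χ x →
  χ x (3 + x) ≢ χ (1 + x) (2 + x) × χ x (4 + x) ≢ χ (1 + x) (2 + x)
constantStar-separates (c₁≡c₂ , c₁≡c₃ , c₁≡c₄) notMono =
    (λ c₃≡ → notMono (c₁≡c₂ , trans c₁≡c₃ c₃≡))
  , (λ c₄≡ → notMono (c₁≡c₂ , trans c₁≡c₄ c₄≡))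

-- The fallback 4 + x is correct only when the star of x is not constant.
avoiding : (ℕ → ℕ → Bool) → ℕ → Bool → ℕ
avoiding χ x c with χ x (1 + x) ≟ᵇ c | χ x (2 + x) ≟ᵇ c | χ x (3 + x) ≟ᵇ c
... | no _  | _     | _     = 1 + x
... | yes _ | no _  | _     = 2 + x
... | yes _ | yes _ | no _  = 3 + x
... | yes _ | yes _ | yes _ = 4 + x

avoiding-range : ∀ χ x c → x < avoiding χ x c × avoiding χ x c ≤ 4 + x
avoiding-range χ x c with χ x (1 + x) ≟ᵇ c | χ x (2 + x) ≟ᵇ c | χ x (3 + x) ≟ᵇ c
... | no _  | _     | _     = n<1+n x , m≤n+m _ 3
... | yes _ | no _  | _     = m<n+m x z<s , m≤n+m _ 2
... | yes _ | yes _ | no _  = m<n+m x z<s , n≤1+n _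
... | yes _ | yes _ | yes _ = m<n+m x z<s , ≤-refl

avoiding-colour : ∀ {χ x} c → ¬ ConstantStar χ x → χ x (avoiding χ x c) ≢ c
avoiding-colour {χ} {x} c notConstant
  with χ x (1 + x) ≟ᵇ c | χ x (2 + x) ≟ᵇ c | χ x (3 + x) ≟ᵇ c
... | no c₁≢c | _       | _       = c₁≢c
... | yes _   | no c₂≢c | _       = c₂≢c
... | yes _   | yes _   | no c₃≢c = c₃≢c
... | yes c₁≡c | yes c₂≡c | yes c₃≡c = λ c₄≡c →
  notConstant (trans c₁≡c (sym c₂≡c) , trans c₁≡c (sym c₃≡c) , trans c₁≡c (sym c₄≡c))

Run : (ℕ → Set) → ℕ → ℕ → Set
Run P n j = ∀ i → i < n → P (j + i)

record Scattered (P : ℕ → Set) (m lo hi : ℕ) : Set where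
  field
    point     : ℕ → ℕ
    in-range  : ∀ k → k < m → lo ≤ point k × point k < hi
    avoids    : ∀ k → k < m → ¬ P (point k)
    ascending : ∀ k → suc k < m → point k < point (suc k)

-- Greedy: a window [lo, lo + n) without gaps is a run; otherwise its gap is the next point
-- and the scan resumes just after it.
run-or-scattered : {P : ℕ → Set} → Decidable P → ∀ n m lo →
  (∃ λ j → j + n ≤ lo + m * n × Run P n j) ⊎ Scattered P m lo (lo + m * n)
run-or-scattered P? n zero lo = inj₂ record
  { point = λ _ → lo ; in-range = λ _ () ; avoids = λ _ () ; ascending = λ _ () }
run-or-scattered {P} P? n (suc m) lo with anyUpTo? (λ i → ¬? (P? (lo + i))) n
... | no noGap = inj₁ (lo , +-monoʳ-≤ lo (m≤m+n n (m * n)) , run)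
  where
  run : Run P n lo
  run i i<n = decidable-stable (P? (lo + i)) (λ ¬P → noGap (i , i<n , ¬P))
... | yes (i , i<n , ¬P) = Sum.map (λ (j , bound , run) → j , ≤-trans bound window , run) extend
                                   (run-or-scattered P? n m lo′)
  where
  lo′ = suc (lo + i)
  lo′≤lo+n : lo′ ≤ lo + n
  lo′≤lo+n = +-monoʳ-< lo i<n
  window : lo′ + m * n ≤ lo + suc m * n
  window = ≤-trans (+-monoˡ-≤ (m * n) lo′≤lo+n) (≤-reflexive (+-assoc lo n (m * n)))
  extend : Scattered P m lo′ (lo′ + m * n) → Scattered P (suc m) lo (lo + suc m * n)
  extend S = record { point = point′ ; in-range = in-range′ ; avoids = avoids′ ; ascending = ascending′ }
    where
    open Scattered S
    point′ = (lo + i) ∷ point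
    in-range′ : ∀ k → k < suc m → lo ≤ point′ k × point′ k < lo + suc m * n
    in-range′ zero    _         = m≤m+n lo i , <-≤-trans lo′≤lo+n (+-monoʳ-≤ lo (m≤m+n n (m * n)))
    in-range′ (suc k) (s≤s k<m) = ≤-trans (m≤m+n lo i) (<⇒≤ (proj₁ (in-range k k<m)))
                                , <-≤-trans (proj₂ (in-range k k<m)) window
    avoids′ : ∀ k → k < suc m → ¬ P (point′ k)
    avoids′ zero    _         = ¬P
    avoids′ (suc k) (s≤s k<m) = avoids k k<m
    ascending′ : ∀ k → suc k < suc m → point′ k < point′ (suc k)
    ascending′ zero    (s≤s 0<m)   = proj₁ (in-range 0 0<m)
    ascending′ (suc k) (s≤s 1+k<m) = ascending k 1+k<m

triple-< : ∀ {t u} → t < u → 2 + 3 * t < 3 * u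
triple-< {t} {u} t<u = <-≤-trans (n<1+n _) (subst (_≤ 3 * u) (*-suc 3 t) (*-monoʳ-≤ 3 t<u))

triangle : ℕ → Block
triangle x = block x (1 + x) (2 + x)

run-embeddings : (χ : ℕ → ℕ → Bool) {r j : ℕ} → j + n ≤ r →
  (∀ t → t < r → ¬ MonoTriangle χ (3 * t)) → Run (ConstantStar χ ∘ (3 *_)) n j →
  Embeddings χ (3 * r) n (F n)
run-embeddings {n} χ {r} {j} j+n≤r noMono run = walk-embeddings χ B ord below sep
  where
  B : ℕ → Block
  B i = triangle (3 * (j + i))

  next : ∀ i → 3 * (j + suc i) ≡ 3 + 3 * (j + i)
  next i = trans (cong (3 *_) (+-suc j i)) (*-suc 3 (j + i))

  j+i<r : ∀ {i} → i < n → j + i < r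
  j+i<r i<n = <-≤-trans (+-monoʳ-< j i<n) j+n≤r

  ord : ∀ i → i < n → Ordered B i
  ord i _ rewrite next (suc i) | next i =
    n<1+n _ , ≺-intro (m<n+m _ {3} z<s) (m<n+m _ {4} z<s) , ≺-intro (m<n+m _ {4} z<s) (m<n+m _ {5} z<s)

  below : ∀ i → i < n → Below (3 * r) (B i)
  below i i<n = <-trans (n<1+n _) (<-trans (n<1+n _) 2+x<3r) , <-trans (n<1+n _) 2+x<3r , 2+x<3r
    where
    2+x<3r = triple-< (j+i<r i<n)

  separates : ∀ i → i < n → let x = 3 * (j + i) in
    χ x (3 * (j + suc i)) ≢ χ (1 + x) (2 + x) × χ x (1 + 3 * (j + suc i)) ≢ χ (1 + x) (2 + x)
  separates i i<n rewrite next i = constantStar-separates {χ} (run i i<n) (noMono (j + i) (j+i<r i<n))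

  sep : ∀ i → suc i < n → Separated χ B i
  sep i 1+i<n _ (inj₁ refl) = proj₁ (separates i (<-trans (n<1+n i) 1+i<n))
  sep i 1+i<n _ (inj₂ refl) = proj₂ (separates i (<-trans (n<1+n i) 1+i<n))

-- Ordered B i looks two points ahead, hence 2 + n points.
scattered-embeddings : (χ : ℕ → ℕ → Bool) {r hi : ℕ} → hi < r →
  Scattered (ConstantStar χ ∘ (3 *_)) (2 + n) 0 hi → Embeddings χ (3 * r) n (F n)
scattered-embeddings {n} χ {r} hi<r S = walk-embeddings χ B ord below sep
  where
  open Scattered S renaming (point to t)
  x : ℕ → ℕ
  x i = 3 * t i
  B : ℕ → Block
  B i = block (x i) (x i) (avoiding χ (x i) (χ (x i) (x (suc i))))

  ord : ∀ i → i < n → Ordered B i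
  ord i i<n =
    proj₁ (avoiding-range χ (x i) _) , ≺-intro xᵢ<xᵢ₊₁ xᵢ<xᵢ₊₁ , ≺-intro right<xᵢ₊₂ right<xᵢ₊₂
    where
    tᵢ<tᵢ₊₁ = ascending i (m<n⇒m<1+n (s≤s i<n))
    xᵢ<xᵢ₊₁ = *-monoʳ-< 3 tᵢ<tᵢ₊₁
    1+tᵢ<tᵢ₊₂ = ≤-<-trans tᵢ<tᵢ₊₁ (ascending (suc i) (s≤s (s≤s i<n)))
    5+xᵢ<xᵢ₊₂ = subst (λ y → 2 + y < x (2 + i)) (*-suc 3 (t i)) (triple-< 1+tᵢ<tᵢ₊₂)
    right<xᵢ₊₂ = ≤-<-trans (proj₂ (avoiding-range χ (x i) _)) (≤-<-trans (n≤1+n _) 5+xᵢ<xᵢ₊₂)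

  below : ∀ i → i < n → Below (3 * r) (B i)
  below i i<n = xᵢ<3r , xᵢ<3r , right<3r
    where
    1+tᵢ<r = ≤-<-trans (proj₂ (in-range i (≤-trans i<n (m≤n+m n 2)))) hi<r
    5+xᵢ<3r = subst (λ y → 2 + y < 3 * r) (*-suc 3 (t i)) (triple-< 1+tᵢ<r)
    xᵢ<3r = ≤-<-trans (m≤n+m _ 5) 5+xᵢ<3r
    right<3r = ≤-<-trans (proj₂ (avoiding-range χ (x i) _)) (≤-<-trans (n≤1+n _) 5+xᵢ<3r)

  sep : ∀ i → suc i < n → Separated χ B i
  sep i 1+i<n v entry same = avoiding-colour {χ} {x i} _ (avoids i i<2+n)
    (sym (trans (cong (χ (x i)) (sym (Sum.reduce entry))) same))
    where
    i<2+n = ≤-trans (<-trans (n<1+n i) 1+i<n) (m≤n+m n 2)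

noMono-embeddings : (χ : ℕ → ℕ → Bool) {r : ℕ} → (2 + n) * n < r →
  (∀ t → t < r → ¬ MonoTriangle χ (3 * t)) → Embeddings χ (3 * r) n (F n)
noMono-embeddings {n} χ big noMono with run-or-scattered (constantStar? χ ∘ (3 *_)) n (2 + n) 0
... | inj₁ (j , j+n≤ , run) = run-embeddings χ (<⇒≤ (≤-<-trans j+n≤ big)) noMono run
... | inj₂ scattered        = scattered-embeddings χ big scattered

alternating-colℕ : (c : Coloring) → Alternating (col c) →
  ∀ b → 1 ≤ b → suc b < size c → colℕ c 0 b ≢ colℕ c 0 (suc b)
alternating-colℕ c alt b 1≤b 1+b<N same =
  alt (fromℕ< 0<N) (fromℕ< b<N) (fromℕ< 1+b<N)
      (toℕ-fromℕ< 0<N) (subst (1 ≤_) (sym (toℕ-fromℕ< b<N)) 1≤b)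
      (trans (toℕ-fromℕ< 1+b<N) (cong suc (sym (toℕ-fromℕ< b<N))))
      (trans (sym (colℕ-fromℕ< c 0<N b<N)) (trans same (colℕ-fromℕ< c 0<N 1+b<N)))
  where
  b<N : b < size c
  b<N = <-trans (n<1+n b) 1+b<N
  0<N : 0 < size c
  0<N = ≤-<-trans z≤n b<N

noMono-colℕ : (c : Coloring) {r : ℕ} → Wealthy2 r c →
              ∀ t → t < r → ¬ MonoTriangle (colℕ c) (3 * t)
noMono-colℕ c (size≡3r , noMono) t t<r (e₁ , e₂) =
  noMono t (fromℕ< x<N) (fromℕ< x+1<N) (fromℕ< x+2<N)
    (toℕ-fromℕ< x<N)
    (trans (toℕ-fromℕ< x+1<N) (+-comm 1 (3 * t)))
    (trans (toℕ-fromℕ< x+2<N) (+-comm 2 (3 * t)))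
    ( trans (sym (colℕ-fromℕ< c x<N x+1<N)) (trans e₁ (colℕ-fromℕ< c x<N x+2<N))
    , trans (sym (colℕ-fromℕ< c x<N x+1<N)) (trans e₂ (colℕ-fromℕ< c x+1<N x+2<N)) )
  where
  x+2<N : 2 + 3 * t < size c
  x+2<N = subst (2 + 3 * t <_) (sym size≡3r) (triple-< t<r)
  x+1<N : 1 + 3 * t < size c
  x+1<N = <-trans (n<1+n _) x+2<N
  x<N : 3 * t < size c
  x<N = <-trans (n<1+n _) x+1<N

-- Reversal

reverse : Coloring → Coloring
reverse c = mkCol (size c) (reversal (col c))

opposite-< : {i j : Fin n} → i Fin.< j → opposite j Fin.< opposite i
opposite-< {i = i} {j} i<j =
  subst₂ _<_ (sym (opposite-prop j)) (sym (opposite-prop i)) (∸-monoʳ-< (s≤s i<j) (toℕ<n j))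

reversal-involutive : (χ : Fin n → Fin n → Bool) → ∀ i j → reversal (reversal χ) i j ≡ χ i j
reversal-involutive χ i j = cong₂ χ (opposite-involutive i) (opposite-involutive j)

reverse-≼ : ∀ {c d} → c ≼ d → reverse c ≼ reverse d
reverse-≼ {c} {d} (f , f-increasing , f-col) =
  opposite ∘ f ∘ opposite ,
  (λ i j i<j → opposite-< (f-increasing _ _ (opposite-< i<j))) ,
  (λ i j i<j → trans (f-col _ _ (opposite-< i<j))
                     (sym (cong₂ (col d) (opposite-involutive _) (opposite-involutive _))))

ideal-SameCol : ∀ {X} → IsIdeal X → {χ ψ : Fin n → Fin n → Bool} →
                SameCol χ ψ → X (mkCol n ψ) → X (mkCol n χ)
ideal-SameCol ideal same = ideal _ _ (id , (λ _ _ i<j → i<j) , same)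

reverse-ideal : ∀ {X} → IsIdeal X → IsIdeal (X ∘ reverse)
reverse-ideal ideal c d c≼d = ideal (reverse c) (reverse d) (reverse-≼ {c} {d} c≼d)

atLeast-reverse : ∀ {X} → AtLeast (X ∘ reverse) n K → AtLeast X n K
atLeast-reverse (g , g∈X , g-distinct) =
  reversal ∘ g , g∈X , λ a b a≢b same → g-distinct a b a≢b (unreverse same)
  where
  unreverse : ∀ {χ ψ} → SameCol (reversal χ) (reversal ψ) → SameCol χ ψ
  unreverse {χ} {ψ} same i j i<j =
    trans (sym (reversal-involutive χ i j))
          (trans (same (opposite j) (opposite i) (opposite-< i<j)) (reversal-involutive ψ i j))

atLeast-alternating : ∀ {X} → IsIdeal X → (c : Coloring) → X c → Alternating (col c) →
                      2 + 2 * n ≤ size c → AtLeast X n (F n)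
atLeast-alternating ideal c Xc alt big =
  embeddings⇒atLeast ideal c Xc (alternating-embeddings (colℕ c) big (alternating-colℕ c alt))

atLeast-wealthy1 : ∀ {X r} → IsIdeal X → (Σ Coloring λ c → X c × Wealthy1 r c) →
                   2 + 2 * n ≤ r → AtLeast X n (F n)
atLeast-wealthy1 ideal (c , Xc , refl , inj₁ alt) big = atLeast-alternating ideal c Xc alt big
atLeast-wealthy1 {X = X} ideal (c , Xc , refl , inj₂ alt) big =
  atLeast-reverse {X = X} (atLeast-alternating (reverse-ideal ideal) (reverse c) X[reverse²c] alt big)
  where
  X[reverse²c] = ideal-SameCol ideal (λ i j _ → reversal-involutive (col c) i j) Xc

atLeast-wealthy2 : ∀ {X r} → IsIdeal X → (Σ Coloring λ c → X c × Wealthy2 r c) →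
                   (2 + n) * n < r → AtLeast X n (F n)
atLeast-wealthy2 {n} ideal (c , Xc , wealthy@(size≡3r , _)) big =
  embeddings⇒atLeast ideal c Xc (subst (λ N → Embeddings (colℕ c) N n (F n)) (sym size≡3r)
                            (noMono-embeddings (colℕ c) big (noMono-colℕ c wealthy)))

lemma3p10 : (X : Coloring → Set) → IsIdeal X →
    (RichIn Wealthy1 X ⊎ RichIn Wealthy2 X) →
    (n : ℕ) → 1 ≤ n → AtLeast X n (F n)
lemma3p10 X ideal (inj₁ rich) n _ = atLeast-wealthy1 ideal (rich (2 + 2 * n) z<s) ≤-refl
lemma3p10 X ideal (inj₂ rich) n _ = atLeast-wealthy2 ideal (rich (suc ((2 + n) * n)) z<s) ≤-refl
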